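{- Let $X$ be a Hausdorff Baire space and let $\mathcal{F}=\{F_\alpha:\alpha<\kappa\}$ be a $K$-partition of $X$. If $\mathrm{sat}(I_\mathcal{F})<\omega$, then there exists an open non-meager set $U\subseteq X$ such that the ideal $I_{\mathcal{F}|_U}$ is maximal.
   Context: A Baire space is a topological space in which every countable intersection of open dense sets is non-empty. A set has the Baire property if it equals $U\triangle M$ with $U$ open and $M$ meager. A $K$-partition of a space $Y$ is a partition of $Y$ into meager sets such that the union of every subfamily has the Baire property. $I_\mathcal{F}=\{A\subseteq\kappa:\bigcup_{\alpha\in A}F_\alpha\text{ is meager}\}$; for open non-meager $U$, $I_{\mathcal{F}|_U}=\{A\subseteq\kappa:\bigcup_{\alpha\in A}(F_\alpha\cap U)\text{ is meager}\}$. For an ideal $I$ on $\kappa$, $\mathrm{sat}(I)$ is the smallest cardinal $\lambda$ such that every antichain in the Boolean algebra $\mathcal{P}(\kappa)/I$ has cardinality less than $\lambda$. An ideal $I$ on $\kappa$ is maximal if it is a proper ideal not properly contained in any proper ideal on $\kappa$ (equivalently, for every $A\subseteq\kappa$, $A\in I$ or $\kappa\setminus A\in I$). -}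

module Defs where

open import Level using (Level; 0ℓ) renaming (suc to lsuc)
open import Data.Nat using (ℕ)
open import Data.Fin using (Fin)
open import Data.Product using (Σ; ∃; _×_; _,_)
open import Data.Sum using (_⊎_)
open import Data.Empty using (⊥)
open import Relation.Nullary using (¬_)
open import Relation.Binary.PropositionalEquality using (_≡_; _≢_)
open import Relation.Unary using (Pred; _∈_; _∉_; _⊆_; _≐_; _∩_; _∪_; _∖_; ∁; U)
open import Function.Definitions using (Injective)

Subset : Set → Set₁
Subset X = Pred X 0ℓ

⋃[_] : {X I : Set} → (I → Subset X) → Subset X
⋃[ f ] = λ x → ∃ λ i → f i x

_△_ : {X : Set} → Subset X → Subset X → Subset X
A △ B = (A ∖ B) ∪ (B ∖ A)

record Topology (X : Set) : Set₁ where
  field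
    IsOpen    : Subset X → Set
    open-resp : ∀ {A B} → A ≐ B → IsOpen A → IsOpen B
    open-univ : IsOpen U
    open-∩    : ∀ {A B} → IsOpen A → IsOpen B → IsOpen (A ∩ B)
    open-⋃    : (I : Set) (f : I → Subset X) → (∀ i → IsOpen (f i)) → IsOpen ⋃[ f ]

module _ {X : Set} (τ : Topology X) where
  open Topology τ

  Hausdorff : Set₁
  Hausdorff = ∀ x y → x ≢ y →
    Σ (Subset X) λ V → Σ (Subset X) λ W →
      IsOpen V × IsOpen W × x ∈ V × y ∈ W × (∀ z → z ∈ V → z ∈ W → ⊥)

  Nonempty : Subset X → Set
  Nonempty A = ∃ λ x → x ∈ A

  interior : Subset X → Pred X (lsuc 0ℓ)
  interior A x = Σ (Subset X) λ V → IsOpen V × x ∈ V × V ⊆ A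

  closure : Subset X → Pred X (lsuc 0ℓ)
  closure A x = ∀ V → IsOpen V → x ∈ V → Nonempty (V ∩ A)

  Dense : Subset X → Set₁
  Dense A = ∀ V → IsOpen V → Nonempty V → Nonempty (V ∩ A)

  NowhereDense : Subset X → Set₁
  NowhereDense A = ∀ x → ¬ (Σ (Subset X) λ V → IsOpen V × x ∈ V × (∀ y → y ∈ V → y ∈ closure A))

  Meager : Subset X → Set₁
  Meager A = Σ (ℕ → Subset X) λ N → (∀ n → NowhereDense (N n)) × A ⊆ ⋃[ N ]

  BaireSpace : Set₁
  BaireSpace = (D : ℕ → Subset X) → (∀ n → IsOpen (D n)) → (∀ n → Dense (D n)) →
    ∃ λ x → ∀ n → D n x

  HasBaireProperty : Subset X → Set₁
  HasBaireProperty A = Σ (Subset X) λ V → Σ (Subset X) λ M →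
    IsOpen V × Meager M × A ≐ (V △ M)

  -- K-partition of X indexed by K (representing the cardinal κ)
  IsKPartition : {K : Set} → (K → Subset X) → Set₁
  IsKPartition {K} F =
    (∀ α → Nonempty (F α)) ×
    (∀ x → ∃ λ α → F α x) ×
    (∀ α β x → F α x → F β x → α ≡ β) ×
    (∀ α → Meager (F α)) ×
    (∀ (A : Subset K) → HasBaireProperty (λ x → ∃ λ α → α ∈ A × F α x))

  IF : {K : Set} → (K → Subset X) → Subset K → Set₁
  IF F A = Meager (λ x → ∃ λ α → α ∈ A × F α x)

  IF∣ : {K : Set} → (K → Subset X) → Subset X → Subset K → Set₁
  IF∣ F V A = Meager (λ x → ∃ λ α → α ∈ A × (F α x × V x))

module _ {K : Set} where
  IsIdeal : (Subset K → Set₁) → Set₁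
  IsIdeal I =
    I (λ _ → ⊥) ×
    (∀ A B → A ⊆ B → I B → I A) ×
    (∀ A B → I A → I B → I (A ∪ B))

  IsProperIdeal : (Subset K → Set₁) → Set₁
  IsProperIdeal I = IsIdeal I × ¬ I U

  IsMaximalIdeal : (Subset K → Set₁) → Set₂
  IsMaximalIdeal I = IsProperIdeal I ×
    (∀ (J : Subset K → Set₁) → IsProperIdeal J → (∀ A → I A → J A) → ∀ A → J A → I A)

  -- An antichain in P(K)/I, given by representatives a j (j ∈ J):
  -- nonzero elements, pairwise meets zero.
  IsAntichain : (Subset K → Set₁) → (J : Set) → (J → Subset K) → Set₁
  IsAntichain I J a = (∀ j → ¬ I (a j)) × (∀ j j' → j ≢ j' → I (a j ∩ a j'))

  SatFinite : (Subset K → Set₁) → Set₁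
  SatFinite I = Σ ℕ λ n → ∀ (J : Set) (a : J → Subset K) → IsAntichain I J a →
    ¬ (Σ (Fin n → J) λ g → Injective _≡_ _≡_ g)

-- Ambient classical metatheory (ZFC): the axiom of choice.
Choice : (ℓ : Level) → Set (lsuc ℓ)
Choice ℓ = {A B : Set ℓ} (R : A → B → Set ℓ) → (∀ a → ∃ (R a)) → Σ (A → B) λ f → ∀ a → R a (f a)

module Submission where

open import Defs
open import Level using (0ℓ; Lift; lift; lower) renaming (suc to lsuc)
open import Function using (_∘_; id)
open import Data.Product using (Σ; _×_; _,_; ∃; proj₁; proj₂)
open import Axiom.ExcludedMiddle using (ExcludedMiddle)
open import Axiom.DoubleNegationElimination using (em⇒dne)
open import Relation.Nullary using (¬_; yes; no)
open import Data.Nat using (ℕ; zero; suc)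
open import Data.Fin using (Fin; zero; suc)
open import Data.Sum using (_⊎_; inj₁; inj₂; [_,_])
open import Data.Empty using (⊥; ⊥-elim)
open import Data.Unit using (tt)
open import Relation.Binary.PropositionalEquality using (_≡_; _≢_; refl; sym; cong; subst)
open import Relation.Unary using (Empty; _∈_; ∅; _⊆_; _≐_; _∩_; _∪_; _∖_; ∁; U)

-- Finite saturation of I_F yields an atom a of P(κ)/I_F: otherwise every positive set
-- splits, and splitting repeatedly produces arbitrarily large antichains. By the Baire
-- property, the union of the pieces indexed by a is V △ M with V open and M meager; V is
-- non-meager because a is not null. Up to the meager set M, every piece meeting V is
-- indexed by a, so the atom property of a says that for every A, either A or its
-- complement is null for F restricted to V, which makes I_{F|V} maximal.

module _ {a} {A : Set a} where

  interleave : (ℕ → A) → (ℕ → A) → ℕ → A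
  interleave f g zero    = f zero
  interleave f g (suc n) = interleave g (f ∘ suc) n

  interleave-hitsˡ : ∀ f g k → ∃ λ n → interleave f g n ≡ f k
  interleave-hitsʳ : ∀ f g k → ∃ λ n → interleave f g n ≡ g k
  interleave-hitsˡ f g zero = zero , refl
  interleave-hitsˡ f g (suc k) with interleave-hitsʳ g (f ∘ suc) k
  ... | n , e = suc n , e
  interleave-hitsʳ f g k with interleave-hitsˡ g (f ∘ suc) k
  ... | n , e = suc n , e

  interleave-all : ∀ {p} (P : A → Set p) {f g} →
                   (∀ n → P (f n)) → (∀ n → P (g n)) → ∀ n → P (interleave f g n)
  interleave-all P pf pg zero    = pf zero
  interleave-all P pf pg (suc n) = interleave-all P pg (pf ∘ suc) n

⋃-indexed : {X K : Set} → (K → Subset X) → Subset K → Subset X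
⋃-indexed F A x = ∃ λ α → α ∈ A × F α x

module _ {X : Set} (τ : Topology X) where
  open Topology τ

  open-∅ : IsOpen ∅
  open-∅ = open-resp ((λ { (() , _) }) , λ ()) (open-⋃ ⊥ ⊥-elim λ ())

  meager-mono : ∀ {A B : Subset X} → A ⊆ B → Meager τ B → Meager τ A
  meager-mono A⊆B (N , N-nowhereDense , B⊆⋃N) = N , N-nowhereDense , B⊆⋃N ∘ A⊆B

  meager-∅ : Meager τ ∅
  meager-∅ = (λ _ → ∅) , ∅-nowhereDense , λ ()
    where
    ∅-nowhereDense : ℕ → NowhereDense τ ∅
    ∅-nowhereDense _ x (V , _ , x∈V , V⊆cl∅) with V⊆cl∅ x x∈V U open-univ tt
    ... | _ , _ , ()

  meager-∪ : ∀ {A B : Subset X} → Meager τ A → Meager τ B → Meager τ (A ∪ B)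
  meager-∪ (N , N-nd , A⊆⋃N) (N′ , N′-nd , B⊆⋃N′) =
    interleave N N′ , interleave-all (NowhereDense τ) N-nd N′-nd , cover
    where
    cover : _ ∪ _ ⊆ ⋃[ interleave N N′ ]
    cover (inj₁ x∈A) with A⊆⋃N x∈A
    ... | k , x∈Nk with interleave-hitsˡ N N′ k
    ... | n , e = n , subst (_ ∈_) (sym e) x∈Nk
    cover (inj₂ x∈B) with B⊆⋃N′ x∈B
    ... | k , x∈N′k with interleave-hitsʳ N N′ k
    ... | n , e = n , subst (_ ∈_) (sym e) x∈N′k

  IF-isIdeal : {K : Set} (F : K → Subset X) → IsIdeal (IF τ F)
  IF-isIdeal F = meager-mono (λ { (_ , () , _) }) meager-∅
               , (λ A B A⊆B → meager-mono λ { (α , α∈A , x∈Fα) → α , A⊆B α∈A , x∈Fα })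
               , λ A B A-null B-null → meager-mono ⋃-∪ (meager-∪ A-null B-null)
    where
    ⋃-∪ : ∀ {A B} → ⋃-indexed F (A ∪ B) ⊆ ⋃-indexed F A ∪ ⋃-indexed F B
    ⋃-∪ (α , inj₁ α∈A , x∈Fα) = inj₁ (α , α∈A , x∈Fα)
    ⋃-∪ (α , inj₂ α∈B , x∈Fα) = inj₂ (α , α∈B , x∈Fα)

  IF-proper : {K : Set} (F : K → Subset X) {V : Subset X} →
              V ⊆ ⋃[ F ] → ¬ Meager τ V → ¬ IF τ F U
  IF-proper F {V} V⊆⋃F V-nonmeager U-null = V-nonmeager (meager-mono V⊆⋃F-indexed U-null)
    where
    V⊆⋃F-indexed : V ⊆ ⋃-indexed F U
    V⊆⋃F-indexed x∈V = let (α , x∈Fα) = V⊆⋃F x∈V in α , tt , x∈Fα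

IsAtom : {K : Set} → (Subset K → Set₁) → Subset K → Set₁
IsAtom I a = ¬ I a × ∀ C → I (a ∩ C) ⊎ I (a ∖ C)

module _ {K : Set} (I : Subset K → Set₁) where

  Splits : Subset K → Set₁
  Splits a = Σ (Subset K) λ C → ¬ I (a ∩ C) × ¬ I (a ∖ C)

  record PositiveDisjointFamily (m : ℕ) : Set₁ where
    field
      piece           : Fin m → Subset K
      rest            : Subset K
      piece-positive  : ∀ i → ¬ I (piece i)
      rest-positive   : ¬ I rest
      pieces-disjoint : ∀ i j → i ≢ j → Empty (piece i ∩ piece j)
      rest-disjoint   : ∀ i → Empty (piece i ∩ rest)

  split-rest : ∀ {m} (D : PositiveDisjointFamily m) → Splits (PositiveDisjointFamily.rest D) →
               PositiveDisjointFamily (suc m)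
  split-rest {m} D (C , rest∩C-positive , rest∖C-positive) = record
    { piece           = piece′
    ; rest            = rest ∩ C
    ; piece-positive  = piece′-positive
    ; rest-positive   = rest∩C-positive
    ; pieces-disjoint = pieces′-disjoint
    ; rest-disjoint   = rest′-disjoint
    }
    where
    open PositiveDisjointFamily D
    piece′ : Fin (suc m) → Subset K
    piece′ zero    = rest ∖ C
    piece′ (suc i) = piece i
    piece′-positive : ∀ i → ¬ I (piece′ i)
    piece′-positive zero    = rest∖C-positive
    piece′-positive (suc i) = piece-positive i
    pieces′-disjoint : ∀ i j → i ≢ j → Empty (piece′ i ∩ piece′ j)
    pieces′-disjoint zero    zero    i≢j = ⊥-elim (i≢j refl)
    pieces′-disjoint zero    (suc j) _   α ((α∈rest , _) , α∈Dj) = rest-disjoint j α (α∈Dj , α∈rest)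
    pieces′-disjoint (suc i) zero    _   α (α∈Di , (α∈rest , _)) = rest-disjoint i α (α∈Di , α∈rest)
    pieces′-disjoint (suc i) (suc j) i≢j = pieces-disjoint i j (i≢j ∘ cong suc)
    rest′-disjoint : ∀ i → Empty (piece′ i ∩ (rest ∩ C))
    rest′-disjoint zero    α ((_ , α∉C) , (_ , α∈C)) = α∉C α∈C
    rest′-disjoint (suc i) α (α∈Di , (α∈rest , _))   = rest-disjoint i α (α∈Di , α∈rest)

  module _ (I-proper : IsProperIdeal I) where
    private
      I-ideal = proj₁ I-proper

    ideal-empty : ∀ {A} → Empty A → I A
    ideal-empty {A} A-empty = proj₁ (proj₂ I-ideal) A ∅ (λ {α} → A-empty α) (proj₁ I-ideal)

    everySplits⇒family : (∀ a → ¬ I a → Splits a) → ∀ m → PositiveDisjointFamily m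
    everySplits⇒family splits zero = record
      { piece = λ () ; rest = U ; piece-positive = λ () ; rest-positive = proj₂ I-proper
      ; pieces-disjoint = λ () ; rest-disjoint = λ () }
    everySplits⇒family splits (suc m) =
      let D = everySplits⇒family splits m
          open PositiveDisjointFamily D
      in split-rest D (splits rest rest-positive)

    family⇒antichain : ∀ {m} (D : PositiveDisjointFamily m) →
                       IsAntichain I (Fin m) (PositiveDisjointFamily.piece D)
    family⇒antichain D = piece-positive , λ i j i≢j → ideal-empty (pieces-disjoint i j i≢j)
      where open PositiveDisjointFamily D

module _ (lem : ∀ {ℓ} → ExcludedMiddle ℓ) where

  dne : ∀ {ℓ} {P : Set ℓ} → ¬ ¬ P → P
  dne = em⇒dne lem

  module _ (ac : ∀ {ℓ} → Choice ℓ) {X : Set} (τ : Topology X) where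
    open Topology τ

    -- The complement of the closure is not a level-0 predicate, so it is replaced by a
    -- union of chosen open neighbourhoods, indexed by X.
    exterior : (A : Subset X) → Σ (Subset X) λ E →
               IsOpen E × Empty (E ∩ A) × (∀ x → ¬ closure τ A x → x ∈ E)
    exterior A = ⋃[ lower-nbhd ] , open-⋃ X lower-nbhd (lower ∘ proj₁ ∘ nbhd-spec ∘ lift)
               , (λ { x ((y , x∈Vy) , x∈A) → proj₁ (proj₂ (nbhd-spec (lift y))) x (x∈Vy , x∈A) })
               , λ x x∉clA → x , proj₂ (proj₂ (nbhd-spec (lift x))) x∉clA
      where
      Nbhd : Lift (lsuc 0ℓ) X → Subset X → Set₁
      Nbhd (lift x) V = Lift (lsuc 0ℓ) (IsOpen V) × Empty (V ∩ A) × (¬ closure τ A x → x ∈ V)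

      nbhd-exists : ∀ x → ∃ (Nbhd x)
      nbhd-exists (lift x) with lem {P = closure τ A x}
      ... | yes x∈clA = ∅ , lift (open-∅ τ) , (λ _ ()) , λ x∉clA → ⊥-elim (x∉clA x∈clA)
      ... | no x∉clA  =
        let (V , V-open , x∈V , V∩A-empty) = dne {P = Σ (Subset X) λ V → IsOpen V × x ∈ V × ¬ Nonempty τ (V ∩ A)}
              λ no-nbhd → x∉clA λ V V-open x∈V → dne λ V∩A-empty → no-nbhd (V , V-open , x∈V , V∩A-empty)
        in V , lift V-open , (λ y y∈V∩A → V∩A-empty (y , y∈V∩A)) , λ _ → x∈V

      nbhd : Lift (lsuc 0ℓ) X → Subset X
      nbhd = proj₁ (ac {lsuc 0ℓ} Nbhd nbhd-exists)

      nbhd-spec : ∀ x → Nbhd x (nbhd x)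
      nbhd-spec = proj₂ (ac {lsuc 0ℓ} Nbhd nbhd-exists)

      lower-nbhd : X → Subset X
      lower-nbhd = nbhd ∘ lift

    exterior-dense : ∀ {A E : Subset X} → NowhereDense τ A →
                     (∀ x → ¬ closure τ A x → x ∈ E) → Dense τ E
    exterior-dense A-nd ∁clA⊆E V V-open (x , x∈V) = dne λ V∩E-empty →
      A-nd x (V , V-open , x∈V , λ y y∈V → dne λ y∉clA → V∩E-empty (y , y∈V , ∁clA⊆E y y∉clA))

    baire⇒¬meager-univ : BaireSpace τ → ¬ Meager τ U
    baire⇒¬meager-univ baire (N , N-nd , U⊆⋃N) =
      let (z , z∈⋂E) = baire E E-open E-dense
          (n , z∈Nn) = U⊆⋃N {z} tt
      in E-misses-N n z (z∈⋂E n , z∈Nn)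
      where
      E : ℕ → Subset X
      E n = proj₁ (exterior (N n))
      E-open : ∀ n → IsOpen (E n)
      E-open n = proj₁ (proj₂ (exterior (N n)))
      E-misses-N : ∀ n → Empty (E n ∩ N n)
      E-misses-N n = proj₁ (proj₂ (proj₂ (exterior (N n))))
      E-dense : ∀ n → Dense τ (E n)
      E-dense n = exterior-dense (N-nd n) (proj₂ (proj₂ (proj₂ (exterior (N n)))))

  module _ {K : Set} {I : Subset K → Set₁} (I-proper : IsProperIdeal I) where

    satFinite⇒atom : SatFinite I → Σ (Subset K) (IsAtom I)
    satFinite⇒atom (n , antichains-small) = dne λ no-atom →
      let D = everySplits⇒family I I-proper (nonatom-splits no-atom) n
      in antichains-small (Fin n) _ (family⇒antichain I I-proper D) (id , id)
      where
      nonatom-splits : ¬ Σ (Subset K) (IsAtom I) → ∀ a → ¬ I a → Splits I a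
      nonatom-splits no-atom a a-positive = dne λ no-split →
        no-atom (a , a-positive , λ C → dne λ neither →
          no-split (C , neither ∘ inj₁ , neither ∘ inj₂))

    ultra⇒maximal : (∀ A → I A ⊎ I (∁ A)) → IsMaximalIdeal I
    ultra⇒maximal ultra = I-proper , extension-below
      where
      extension-below : ∀ J → IsProperIdeal J → (∀ A → I A → J A) → ∀ A → J A → I A
      extension-below J ((_ , J-mono , J-∪) , J-proper) I⊆J A A∈J with ultra A
      ... | inj₁ A∈I  = A∈I
      ... | inj₂ ∁A∈I = ⊥-elim (J-proper (J-mono U (A ∪ ∁ A) excluded-middle
                                           (J-∪ A (∁ A) A∈J (I⊆J (∁ A) ∁A∈I))))
        where
        excluded-middle : U ⊆ A ∪ ∁ A
        excluded-middle {α} _ with lem {P = A α}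
        ... | yes α∈A = inj₁ α∈A
        ... | no α∉A  = inj₂ α∉A

  module Localization {X : Set} (τ : Topology X) {K : Set} (F : K → Subset X)
                      (F-covers : ∀ x → ∃ λ α → F α x)
                      (F-disjoint : ∀ α β x → F α x → F β x → α ≡ β)
                      {a : Subset K} {V M : Subset X} (M-meager : Meager τ M)
                      (⋃a≐V△M : ⋃-indexed F a ≐ (V △ M)) where

    open-part-nonmeager : ¬ IF τ F a → ¬ Meager τ V
    open-part-nonmeager a-positive V-meager =
      a-positive (meager-mono τ (△⊆∪ ∘ proj₁ ⋃a≐V△M) (meager-∪ τ V-meager M-meager))
      where
      △⊆∪ : V △ M ⊆ V ∪ M
      △⊆∪ (inj₁ (x∈V , _)) = inj₁ x∈V
      △⊆∪ (inj₂ (x∈M , _)) = inj₂ x∈M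

    -- Off M, a point of V lies in a piece indexed by a, and the pieces are disjoint.
    null-in-a⇒null-in-V : ∀ A → IF τ F (a ∩ A) → IF∣ τ F V A
    null-in-a⇒null-in-V A a∩A-null = meager-mono τ ⊆-⋃a∩A∪M (meager-∪ τ a∩A-null M-meager)
      where
      ⊆-⋃a∩A∪M : ⋃-indexed (λ α → F α ∩ V) A ⊆ ⋃-indexed F (a ∩ A) ∪ M
      ⊆-⋃a∩A∪M {x} (α , α∈A , x∈Fα , x∈V) with lem {P = α ∈ a}
      ... | yes α∈a = inj₁ (α , (α∈a , α∈A) , x∈Fα)
      ... | no α∉a  = inj₂ (dne λ x∉M →
              let (β , β∈a , x∈Fβ) = proj₂ ⋃a≐V△M (inj₁ (x∈V , x∉M))
              in α∉a (subst (_∈ a) (F-disjoint β α x x∈Fβ x∈Fα) β∈a))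

    atom⇒maximal-on-open-part : IsAtom (IF τ F) a → IsMaximalIdeal (IF∣ τ F V)
    atom⇒maximal-on-open-part (a-positive , a-atom) = ultra⇒maximal IF∣-isProper ultra
      where
      -- IF∣ τ F V is IF τ for the family α ↦ F α ∩ V.
      IF∣-isProper : IsProperIdeal (IF∣ τ F V)
      IF∣-isProper = IF-isIdeal τ (λ α → F α ∩ V)
                   , IF-proper τ (λ α → F α ∩ V) (λ {x} x∈V → proj₁ (F-covers x) , proj₂ (F-covers x) , x∈V)
                               (open-part-nonmeager a-positive)
      ultra : ∀ A → IF∣ τ F V A ⊎ IF∣ τ F V (∁ A)
      ultra A = [ inj₁ ∘ null-in-a⇒null-in-V A , inj₂ ∘ null-in-a⇒null-in-V (∁ A) ] (a-atom A)

mainTheorem4 : (lem : ∀ {ℓ} → ExcludedMiddle ℓ) → (ac : ∀ {ℓ} → Choice ℓ) →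
    {X : Set} (τ : Topology X) → Hausdorff τ → BaireSpace τ →
    {K : Set} (F : K → Subset X) → IsKPartition τ F →
    SatFinite (IF τ F) →
    Σ (Subset X) λ V → Topology.IsOpen τ V × ¬ Meager τ V × IsMaximalIdeal (IF∣ τ F V)
mainTheorem4 lem ac τ _ baire F (_ , F-covers , F-disjoint , _ , F-baire) sat =
  let IF-isProper = IF-isIdeal τ F , IF-proper τ F (λ {x} _ → F-covers x) (baire⇒¬meager-univ lem ac τ baire)
      (a , a-atom) = satFinite⇒atom lem IF-isProper sat
      (V , M , V-open , M-meager , ⋃a≐V△M) = F-baire a
      open Localization lem τ F F-covers F-disjoint M-meager ⋃a≐V△M
  in V , V-open , open-part-nonmeager (proj₁ a-atom) , atom⇒maximal-on-open-part a-atom
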